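{- For all integers $m\ge 2$ and all $n\in\mathbb{N}$, we have $g_m(n)\in\mathbb{N}\setminus\mathbb{P}$, where $\mathbb{P}$ is the set of primes.
   Context: $\mathbb{N}=\{0,1,2,\dots\}$, $\mathbb{P}$ is the set of prime numbers. For an integer $m\ge 2$, an $m$-product sequence is a finite sequence of integers $a_1\le a_2\le\dots\le a_t$ such that $\prod_{i=1}^t a_i=R^m$ for some $R\in\mathbb{N}$ and no integer appears more than $m-1$ times in the sequence. For $n\in\mathbb{N}$, $g_m(n)$ is the least integer $s$ such that there exists an $m$-product sequence $a_1\le\dots\le a_t$ with $a_1=n$ and $a_t=s$. -}

module Defs where

open import Data.Nat using (ℕ; _≤_; _∸_; _^_; _≟_)
open import Data.List using (List; head; last; filter; length)
open import Data.Nat.ListAction using (product)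
open import Data.List.Relation.Unary.Linked using (Linked)
open import Data.Maybe using (just)
open import Data.Product using (Σ; _×_)
open import Relation.Binary.PropositionalEquality using (_≡_)

-- An m-product sequence: a nondecreasing finite sequence whose product is
-- an m-th power R^m (R ∈ ℕ) and in which no value occurs more than m-1 times.
-- (Entries are naturals: in g_m(n) the first entry is n ∈ ℕ and the sequence
-- is nondecreasing, so all entries are ≥ 0.)
IsMProductSeq : ℕ → List ℕ → Set
IsMProductSeq m as =
  Linked _≤_ as
  × Σ ℕ (λ R → product as ≡ R ^ m)
  × ((x : ℕ) → length (filter (_≟ x) as) ≤ m ∸ 1)

Attainable : ℕ → ℕ → ℕ → Set
Attainable m n s =
  Σ (List ℕ) (λ as → IsMProductSeq m as × head as ≡ just n × last as ≡ just s)

IsG : ℕ → ℕ → ℕ → Set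
IsG m n s = Attainable m n s × ((s' : ℕ) → Attainable m n s' → s ≤ s')

-- For n ≥ 1, suppose the last entry p of an m-product sequence starting at n were
-- prime. All entries lie in [1, p], so the product is p^c q with p ∤ q, where the
-- multiplicity c of p satisfies 1 ≤ c ≤ m - 1; but a prime dividing an m-th power
-- divides it at least m times. Some value is attainable (n, n^(m-1) 2^m), and
-- attainability of a given value is decided by a finite search, so the least
-- attainable value exists constructively. For n = 0 the sequence 0 gives g_m(0) = 0.
module Submission where

open import Defs
open import Data.Nat using (ℕ; _≤_)
open import Data.Nat.Primality using (Prime)
open import Data.Product using (Σ; _×_)
open import Relation.Nullary using (¬_)
open import Data.Nat
  using (zero; suc; _+_; _*_; _∸_; _^_; _<_; _≟_; _≤?_; z≤n; s≤s; >-nonZero)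
open import Data.Nat.Properties
open import Data.Nat.Divisibility
  using (_∣_; ∣-refl; ∣-trans; ∣⇒≤; ∣1⇒≡1; m∣m*n; ∣m⇒∣m*n; *-pres-∣; *-cancelˡ-∣)
open import Data.Nat.Primality using (euclidsLemma; ¬prime[0]; ¬prime[1]; prime⇒nonZero)
open import Data.Nat.ListAction using (product)
open import Data.List using (List; []; _∷_; head; last; filter; length)
open import Data.List.Properties using (length-filter; filter-accept; filter-reject; filter-some; filter-none)
open import Data.List.Membership.Propositional using (_∈_; _∉_)
open import Data.List.Membership.DecPropositional _≟_ using (_∈?_)
open import Data.List.Relation.Unary.All as All using (All; []; _∷_)
open import Data.List.Relation.Unary.All.Properties using (¬Any⇒All¬)
open import Data.List.Relation.Unary.Any as Any using (here; there)
open import Data.List.Relation.Unary.Linked using (Linked; [-]; _∷_; linked?)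
open import Data.List.Relation.Unary.Linked.Properties using (Linked⇒All)
open import Data.Maybe using (just)
open import Data.Maybe.Properties using (≡-dec)
open import Data.Product using (∃; _,_; proj₂)
open import Data.Sum using (inj₁; inj₂; [_,_]′)
open import Data.Empty using (⊥-elim)
open import Function using (id; _∘′_)
open import Relation.Nullary using (Dec; yes; no)
open import Relation.Nullary.Decidable using (_×-dec_; map′)
open import Relation.Unary using (Decidable)
open import Relation.Binary.PropositionalEquality
open import Algebra.Properties.CommutativeSemigroup *-commutativeSemigroup using (x∙yz≈y∙xz)

private
  variable
    c d k m n p q r s x y : ℕ
    xs : List ℕ

^-monoˡ-∣ : ∀ m → d ∣ n → d ^ m ∣ n ^ m
^-monoˡ-∣ zero    _   = ∣-refl
^-monoˡ-∣ (suc m) d∣n = *-pres-∣ d∣n (^-monoˡ-∣ m d∣n)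

^-monoʳ-∣ : ∀ p → m ≤ n → p ^ m ∣ p ^ n
^-monoʳ-∣ {m} {n} p m≤n =
  subst (p ^ m ∣_) (trans (sym (^-distribˡ-+-* p m (n ∸ m))) (cong (p ^_) (m+[n∸m]≡n m≤n)))
        (m∣m*n (p ^ (n ∸ m)))

prime⇒∤1 : Prime p → ¬ p ∣ 1
prime⇒∤1 pp p∣1 = ¬prime[1] (subst Prime (∣1⇒≡1 p∣1) pp)

prime∣^⇒∣ : Prime p → ∀ n m → p ∣ n ^ m → p ∣ n
prime∣^⇒∣ pp n zero    p∣1   = ⊥-elim (prime⇒∤1 pp p∣1)
prime∣^⇒∣ pp n (suc m) p∣n^m = [ id , prime∣^⇒∣ pp n m ]′ (euclidsLemma n (n ^ m) pp p∣n^m)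

-- If p^c q = r^m then p ∣ r, so p^m ∣ p^c q; were c < m this would leave p ∣ q.
p^c*q≡r^m⇒m≤c : ∀ r m → Prime p → ¬ p ∣ q → 0 < c → p ^ c * q ≡ r ^ m → m ≤ c
p^c*q≡r^m⇒m≤c {p} {q} {suc c} r m pp p∤q _ p^c*q≡r^m = ≮⇒≥ λ c<m →
  p∤q (*-cancelˡ-∣ (p ^ suc c) {{m^n≢0 p (suc c) {{prime⇒nonZero pp}}}}
        (∣-trans (subst (_∣ p ^ m) (*-comm p (p ^ suc c)) (^-monoʳ-∣ p c<m))
                 (subst (p ^ m ∣_) (sym p^c*q≡r^m) (^-monoˡ-∣ m p∣r))))
  where
  p∣r : p ∣ r
  p∣r = prime∣^⇒∣ pp r m (subst (p ∣_) p^c*q≡r^m (∣m⇒∣m*n q (m∣m*n (p ^ c))))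

^-distribʳ-* : ∀ a b n → (a * b) ^ n ≡ a ^ n * b ^ n
^-distribʳ-* a b zero    = refl
^-distribʳ-* a b (suc n) =
  trans (cong (a * b *_) (^-distribʳ-* a b n)) ([m*n]*[o*p]≡[m*o]*[n*p] a b (a ^ n) (b ^ n))

m≤m^[1+n] : ∀ m n → m ≤ m ^ suc n
m≤m^[1+n] zero    n = z≤n
m≤m^[1+n] (suc m) n = m≤m*n (suc m) (suc m ^ n) {{m^n≢0 (suc m) n}}

isPower? : ∀ k a → Dec (Σ ℕ λ R → a ≡ R ^ suc k)
isPower? k a = map′ (λ (R , _ , a≡R^m) → R , a≡R^m)
                    (λ (R , a≡R^m) → R , s≤s (subst (R ≤_) (sym a≡R^m) (m≤m^[1+n] R k)) , a≡R^m)
                    (anyUpTo? (λ R → a ≟ R ^ suc k) (suc a))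

count : ℕ → List ℕ → ℕ
count x xs = length (filter (_≟ x) xs)

count-∷-≡ : ∀ x xs → count x (x ∷ xs) ≡ suc (count x xs)
count-∷-≡ x xs = cong length (filter-accept (_≟ x) refl)

count-∷-≢ : ∀ x xs → y ≢ x → count x (y ∷ xs) ≡ count x xs
count-∷-≢ x xs y≢x = cong length (filter-reject (_≟ x) y≢x)

∈⇒count>0 : x ∈ xs → 0 < count x xs
∈⇒count>0 x∈xs = filter-some (_≟ _) (Any.map sym x∈xs)

∉⇒count≡0 : ∀ xs → x ∉ xs → count x xs ≡ 0
∉⇒count≡0 xs x∉xs = cong length (filter-none (_≟ _) (All.map ≢-sym (¬Any⇒All¬ xs x∉xs)))

counts≤? : ∀ c xs → Dec (∀ x → count x xs ≤ c)
counts≤? c xs =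
  map′ everywhere (λ h → All.tabulate λ {y} _ → h y) (All.all? (λ y → count y xs ≤? c) xs)
  where
  everywhere : All (λ y → count y xs ≤ c) xs → ∀ x → count x xs ≤ c
  everywhere bounded x with x ∈? xs
  ... | yes x∈xs = All.lookup bounded x∈xs
  ... | no  x∉xs = subst (_≤ c) (sym (∉⇒count≡0 xs x∉xs)) z≤n

countBelow : ℕ → List ℕ → ℕ
countBelow zero    xs = 0
countBelow (suc k) xs = count k xs + countBelow k xs

countBelow-∷-≥ : ∀ k xs → k ≤ y → countBelow k (y ∷ xs) ≡ countBelow k xs
countBelow-∷-≥ zero    xs _   = refl
countBelow-∷-≥ (suc k) xs k<y =
  cong₂ _+_ (count-∷-≢ k xs (≢-sym (<⇒≢ k<y))) (countBelow-∷-≥ k xs (<⇒≤ k<y))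

countBelow-∷-< : ∀ k xs → y < k → countBelow k (y ∷ xs) ≡ suc (countBelow k xs)
countBelow-∷-< {y} (suc k) xs y<1+k with y ≟ k
... | yes refl = cong₂ _+_ (count-∷-≡ y xs) (countBelow-∷-≥ y xs ≤-refl)
... | no  y≢k  =
  trans (cong₂ _+_ (count-∷-≢ k xs y≢k) (countBelow-∷-< k xs (≤∧≢⇒< (≤-pred y<1+k) y≢k)))
        (+-suc (count k xs) (countBelow k xs))

length≡countBelow : ∀ k xs → All (_< k) xs → length xs ≡ countBelow k xs
length≡countBelow zero    []       []          = refl
length≡countBelow (suc k) []       []          = length≡countBelow k [] []
length≡countBelow k       (y ∷ xs) (y<k ∷ xs<k) =
  trans (cong suc (length≡countBelow k xs xs<k)) (sym (countBelow-∷-< k xs y<k))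

countBelow≤k*c : ∀ k xs → (∀ x → count x xs ≤ c) → countBelow k xs ≤ k * c
countBelow≤k*c zero    xs _       = z≤n
countBelow≤k*c (suc k) xs counts≤ = +-mono-≤ (counts≤ k) (countBelow≤k*c k xs counts≤)

length≤k*c : ∀ k xs → All (_< k) xs → (∀ x → count x xs ≤ c) → length xs ≤ k * c
length≤k*c k xs xs<k counts≤ =
  subst (_≤ _) (sym (length≡countBelow k xs xs<k)) (countBelow≤k*c k xs counts≤)

last⇒∈ : ∀ xs → last xs ≡ just s → s ∈ xs
last⇒∈ (x ∷ [])     refl    = here refl
last⇒∈ (x ∷ y ∷ xs) last≡s = there (last⇒∈ (y ∷ xs) last≡s)

sorted⇒All≤last : ∀ xs → Linked _≤_ xs → last xs ≡ just s → All (_≤ s) xs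
sorted⇒All≤last (x ∷ [])     _             refl   = ≤-refl ∷ []
sorted⇒All≤last (x ∷ y ∷ xs) (x≤y ∷ sorted) last≡s = ≤-trans x≤y (All.head y∷xs≤s) ∷ y∷xs≤s
  where
  y∷xs≤s : All (_≤ _) (y ∷ xs)
  y∷xs≤s = sorted⇒All≤last (y ∷ xs) sorted last≡s

product-split : Prime p → All (λ y → p ∣ y → y ≡ p) xs →
                ∃ λ q → product xs ≡ p ^ count p xs * q × ¬ p ∣ q
product-split pp [] = 1 , refl , prime⇒∤1 pp
product-split {p} {y ∷ xs} pp (p∣y⇒y≡p ∷ rest) with product-split pp rest | y ≟ p
... | q , product≡ , p∤q | yes refl rewrite count-∷-≡ y xs =
  q , trans (cong (y *_) product≡) (sym (*-assoc y (y ^ count y xs) q)) , p∤q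
... | q , product≡ , p∤q | no  y≢p  rewrite count-∷-≢ p xs y≢p =
  y * q , trans (cong (y *_) product≡) (x∙yz≈y∙xz y (p ^ count p xs) q) ,
  λ p∣yq → [ y≢p ∘′ p∣y⇒y≡p , p∤q ]′ (euclidsLemma y q pp p∣yq)

anyList? : {P : List ℕ → Set} → (∀ xs → Dec (P xs)) → ∀ L b →
           Dec (∃ λ xs → length xs ≤ L × All (_< b) xs × P xs)
anyList? P? L b with P? []
... | yes P[] = yes ([] , z≤n , [] , P[])
anyList? P? zero b | no ¬P[] = no λ { ([] , _ , _ , P[]) → ¬P[] P[] ; (_ ∷ _ , () , _) }
anyList? {P} P? (suc L) b | no ¬P[]
  with anyUpTo? (λ x → anyList? (λ xs → P? (x ∷ xs)) L b) b
... | yes (x , x<b , xs , ∣xs∣≤L , xs<b , Px∷xs) = yes (x ∷ xs , s≤s ∣xs∣≤L , x<b ∷ xs<b , Px∷xs)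
... | no ¬P∷ = no λ
  { ([] , _ , _ , P[]) → ¬P[] P[]
  ; (x ∷ xs , s≤s ∣xs∣≤L , x<b ∷ xs<b , Px∷xs) → ¬P∷ (x , x<b , xs , ∣xs∣≤L , xs<b , Px∷xs) }

module _ {P : ℕ → Set} (P? : Decidable P) where

  least-witness-below : ∀ b → (∃ λ n → n < b × P n) → ∃ λ n → P n × (∀ k → P k → n ≤ k)
  least-witness-below (suc b) (n , s≤s n≤b , Pn) with anyUpTo? P? b
  ... | yes below = least-witness-below b below
  ... | no ∄below = b , Pb , λ k Pk → ≮⇒≥ λ k<b → ∄below (k , k<b , Pk)
    where
    Pb : P b
    Pb with m≤n⇒m<n∨m≡n n≤b
    ... | inj₁ n<b  = ⊥-elim (∄below (n , n<b , Pn))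
    ... | inj₂ refl = Pn

  least-witness : P n → ∃ λ n → P n × (∀ k → P k → n ≤ k)
  least-witness {n} Pn = least-witness-below (suc n) (n , ≤-refl , Pn)

isMProductSeq? : ∀ k → Decidable (IsMProductSeq (suc k))
isMProductSeq? k xs = linked? _≤?_ xs ×-dec isPower? k (product xs) ×-dec counts≤? k xs

-- All entries are < s + 1 and occur at most k times, so the search is finite.
attainable? : ∀ k n s → Dec (Attainable (suc k) n s)
attainable? k n s =
  map′ (λ (xs , _ , _ , att) → xs , att) bounded (anyList? endpoints? (suc s * k) (suc s))
  where
  endpoints? : ∀ xs → Dec (IsMProductSeq (suc k) xs × head xs ≡ just n × last xs ≡ just s)
  endpoints? xs =
    isMProductSeq? k xs ×-dec ≡-dec _≟_ (head xs) (just n) ×-dec ≡-dec _≟_ (last xs) (just s)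
  bounded : Attainable (suc k) n s →
            ∃ λ xs → length xs ≤ suc s * k × All (_< suc s) xs ×
                     IsMProductSeq (suc k) xs × head xs ≡ just n × last xs ≡ just s
  bounded (xs , att@((sorted , _ , counts≤) , _ , last≡s)) =
    xs , length≤k*c (suc s) xs xs<1+s counts≤ , xs<1+s , att
    where
    xs<1+s : All (_< suc s) xs
    xs<1+s = All.map s≤s (sorted⇒All≤last xs sorted last≡s)

attainable⇒¬prime : Attainable (suc k) (suc n) p → ¬ Prime p
attainable⇒¬prime {k} {n} {p} (xs@(_ ∷ _) , (sorted , (r , product≡r^m) , counts≤) , refl , last≡p) pp =
  let q , product≡ , p∤q = product-split pp only-p
      p∈xs = last⇒∈ xs last≡p
      m≤c = p^c*q≡r^m⇒m≤c r (suc k) pp p∤q (∈⇒count>0 p∈xs) (trans (sym product≡) product≡r^m)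
  in 1+n≰n (≤-trans m≤c (counts≤ p))
  where
  only-p : All (λ y → p ∣ y → y ≡ p) xs
  only-p = All.zipWith
    (λ (1+n≤y , y≤p) p∣y → ≤-antisym y≤p (∣⇒≤ {{>-nonZero (≤-trans (s≤s z≤n) 1+n≤y)}} p∣y))
                       (Linked⇒All ≤-trans ≤-refl sorted , sorted⇒All≤last xs sorted last≡p)

count-pair≤1 : x ≢ y → ∀ z → count z (x ∷ y ∷ []) ≤ 1
count-pair≤1 {x} {y} x≢y z with x ≟ z
... | yes refl =
  subst (_≤ 1) (sym (trans (count-∷-≡ x (y ∷ [])) (cong suc (count-∷-≢ x [] (≢-sym x≢y))))) ≤-refl
... | no  x≢z  = subst (_≤ 1) (sym (count-∷-≢ z (y ∷ []) x≢z)) (length-filter (_≟ z) (y ∷ []))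

zero-attainable : Attainable (suc (suc k)) 0 0
zero-attainable =
  0 ∷ [] , ([-] , (0 , refl) , λ z → ≤-trans (length-filter (_≟ z) (0 ∷ [])) (s≤s z≤n)) , refl , refl

pair-attainable : x < y → x * y ≡ r ^ suc (suc k) → Attainable (suc (suc k)) x y
pair-attainable {x} {y} {r} x<y xy≡r^m =
  x ∷ y ∷ [] ,
  (<⇒≤ x<y ∷ [-] , (r , trans (cong (x *_) (*-identityʳ y)) xy≡r^m) ,
   λ z → ≤-trans (count-pair≤1 (<⇒≢ x<y) z) (s≤s z≤n)) ,
  refl , refl

-- n · n^(m-1) 2^m = (2n)^m, and the factor 2^m makes the second entry exceed n.
positive-attainable : ∀ k n → ∃ (Attainable (suc (suc k)) (suc n))
positive-attainable k n = b , pair-attainable a<b a*b≡[a*2]^m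
  where
  a b : ℕ
  a = suc n
  b = a ^ suc k * 2 ^ suc (suc k)
  a<b : a < b
  a<b = ≤-<-trans (m≤m^[1+n] a k)
          (m<m*n (a ^ suc k) (2 ^ suc (suc k)) {{m^n≢0 a (suc k)}} (m≤m*n 2 (2 ^ suc k) {{m^n≢0 2 (suc k)}}))
  a*b≡[a*2]^m : a * b ≡ (a * 2) ^ suc (suc k)
  a*b≡[a*2]^m =
    trans (sym (*-assoc a (a ^ suc k) (2 ^ suc (suc k)))) (sym (^-distribʳ-* a 2 (suc (suc k))))

lemma5p2 : (m : ℕ) → 2 ≤ m → (n : ℕ) → Σ ℕ (λ s → IsG m n s × ¬ Prime s)
lemma5p2 (suc (suc k)) (s≤s (s≤s z≤n)) zero = 0 , (zero-attainable , λ _ _ → z≤n) , ¬prime[0]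
lemma5p2 (suc (suc k)) (s≤s (s≤s z≤n)) (suc n)
  with s , attainable , minimal ←
         least-witness (attainable? (suc k) (suc n)) (proj₂ (positive-attainable k n)) =
  s , (attainable , minimal) , attainable⇒¬prime attainable
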